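{- For every finite simple graph $G$, $\operatorname{mc}(G^c)\geq \chi(G)$.
   Context: $G^c$ is the complement of $G$, $\operatorname{mc}(H)$ is the number of maximal cliques of $H$, and $\chi(G)$ is the chromatic number of $G$. -}

module Defs where

open import Data.Nat using (ℕ)
open import Data.Bool using (Bool; true; false; not; _∧_; T)
open import Data.Fin using (Fin)
open import Data.Fin.Subset using (Subset; _∈_; _⊂_)
open import Data.List using (List; filter; length)
open import Data.Product using (_×_; Σ; ∃)
open import Relation.Binary.PropositionalEquality using (_≡_)
open import Relation.Nullary using (¬_; Dec)
open import Relation.Unary using (Decidable)

record Graph (n : ℕ) : Set where
  field
    adj   : Fin n → Fin n → Bool
    irrefl : ∀ v → adj v v ≡ false
    sym    : ∀ u v → adj u v ≡ adj v u
open Graph public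

-- Complement graph: distinct vertices are adjacent iff they are not adjacent in G.
-- (Since adj v v ≡ false, we must force false on the diagonal.)
open import Data.Fin using (_≟_)
open import Relation.Nullary using (yes; no)
open import Relation.Binary.PropositionalEquality using (refl; cong)

private
  neq : ∀ {n} → Fin n → Fin n → Bool
  neq u v with u ≟ v
  ... | yes _ = false
  ... | no  _ = true

  neq-refl : ∀ {n} (v : Fin n) → neq v v ≡ false
  neq-refl v with v ≟ v
  ... | yes _ = refl
  ... | no v≢v with v≢v refl
  ...   | ()

  neq-sym : ∀ {n} (u v : Fin n) → neq u v ≡ neq v u
  neq-sym u v with u ≟ v | v ≟ u
  ... | yes _ | yes _ = refl
  ... | yes p | no q with q (Relation.Binary.PropositionalEquality.sym p)
  ...   | ()
  neq-sym u v | no p | yes q with p (Relation.Binary.PropositionalEquality.sym q)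
  ...   | ()
  neq-sym u v | no _ | no _ = refl

  ∧-sym-lemma : ∀ {a b c d : Bool} → a ≡ c → b ≡ d → (a ∧ b) ≡ (c ∧ d)
  ∧-sym-lemma refl refl = refl

complement : ∀ {n} → Graph n → Graph n
complement {n} G = record
  { adj    = λ u v → neq u v ∧ not (adj G u v)
  ; irrefl = λ v → cong (_∧ not (adj G v v)) (neq-refl v)
  ; sym    = λ u v → ∧-sym-lemma (neq-sym u v) (cong not (Graph.sym G u v))
  }

IsClique : ∀ {n} → Graph n → Subset n → Set
IsClique G S = ∀ u v → u ∈ S → v ∈ S → ¬ (u ≡ v) → T (adj G u v)

IsMaximalClique : ∀ {n} → Graph n → Subset n → Set
IsMaximalClique G S = IsClique G S × (∀ S′ → S ⊂ S′ → ¬ IsClique G S′)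

open import Data.Fin.Subset using () renaming (⊥ to ∅)
open import Data.Vec using (Vec; []; _∷_)
open import Data.List using ([]; _∷_; map; _++_)

allSubsets : ∀ n → List (Subset n)
allSubsets ℕ.zero    = [] ∷ []
allSubsets (ℕ.suc n) = map (false ∷_) (allSubsets n) ++ map (true ∷_) (allSubsets n)

-- mc(G): the number of maximal cliques of G.  Requires deciding maximality,
-- which is supplied as an argument (any decision procedure gives the same count).
mc : ∀ {n} (G : Graph n) → Decidable (IsMaximalClique G) → ℕ
mc {n} G dec = length (filter dec (allSubsets n))

ProperColouring : ∀ {n} → Graph n → ℕ → Set
ProperColouring {n} G k =
  Σ (Fin n → Fin k) λ c → ∀ u v → T (adj G u v) → ¬ (c u ≡ c v)

χ≤ : ∀ {n} → Graph n → ℕ → Set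
χ≤ G k = ProperColouring G k

-- Greedily extending {v} to a maximal clique of Gᶜ shows that the maximal
-- cliques of Gᶜ cover the vertices.  Colouring each vertex by the position,
-- in the list of all maximal cliques, of one containing it is proper: two
-- vertices of the same colour lie in a common clique of Gᶜ, so they are not
-- adjacent in G.
{-# OPTIONS --safe #-}
module Submission where

open import Defs
open import Data.Nat using (ℕ)
open import Relation.Unary using (Decidable)
open import Data.Bool using (true; false; not; T; T?)
open import Data.Bool.Properties using (T-∧; T-not-≡)
open import Data.Fin using (Fin; _≟_)
open import Data.Fin.Subset using (Subset; _∈_; _⊆_; _∪_; ⁅_⁆)
open import Data.Fin.Subset.Properties using (x∈⁅x⁆; x∈⁅y⁆⇒x≡y; p⊆p∪q; q⊆p∪q; x∈p∪q⁻; _∈?_)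
open import Data.Fin.Properties using (all?)
open import Data.List using (List; []; _∷_; allFin; filter; length; lookup; map)
open import Data.List.Relation.Unary.Any as Any using (Any; here; there; index)
open import Data.List.Relation.Unary.Any.Properties using (lookup-index)
import Data.List.Membership.Propositional as List
open import Data.List.Membership.Propositional.Properties
  using (∈-allFin; ∈-filter⁺; ∈-filter⁻; ∈-lookup; ∈-++⁺ˡ; ∈-++⁺ʳ; ∈-map⁺)
open import Data.Product using (Σ; _×_; _,_; proj₁; proj₂)
open import Data.Sum using (inj₁; inj₂)
open import Data.Vec using ([]; _∷_)
open import Data.Empty using (⊥-elim)
open import Function.Bundles using (Equivalence)
open import Relation.Nullary using (¬_; Dec; yes; no)
open import Relation.Nullary.Decidable using (_→-dec_; ¬?)
open import Relation.Binary.PropositionalEquality using (_≡_; refl; subst)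

∈-allSubsets : ∀ {n} (S : Subset n) → S List.∈ allSubsets n
∈-allSubsets []          = here refl
∈-allSubsets (false ∷ S) = ∈-++⁺ˡ (∈-map⁺ (false ∷_) (∈-allSubsets S))
∈-allSubsets (true ∷ S)  =
  ∈-++⁺ʳ (map (false ∷_) (allSubsets _)) (∈-map⁺ (true ∷_) (∈-allSubsets S))

module MaximalExtension {n : ℕ} (H : Graph n) where

  AdjacentToAll : Subset n → Fin n → Set
  AdjacentToAll S w = ∀ u → u ∈ S → ¬ u ≡ w → T (adj H u w)

  adjacentToAll? : ∀ S w → Dec (AdjacentToAll S w)
  adjacentToAll? S w = all? λ u → (u ∈? S) →-dec (¬? (u ≟ w) →-dec T? (adj H u w))

  extend : Subset n → List (Fin n) → Subset n
  extend S []       = S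
  extend S (w ∷ ws) with adjacentToAll? S w
  ... | yes _ = extend (S ∪ ⁅ w ⁆) ws
  ... | no  _ = extend S ws

  ⊆-extend : ∀ S ws → S ⊆ extend S ws
  ⊆-extend S []       u∈S = u∈S
  ⊆-extend S (w ∷ ws) u∈S with adjacentToAll? S w
  ... | yes _ = ⊆-extend (S ∪ ⁅ w ⁆) ws (p⊆p∪q ⁅ w ⁆ u∈S)
  ... | no  _ = ⊆-extend S ws u∈S

  ⁅⁆-isClique : ∀ v → IsClique H ⁅ v ⁆
  ⁅⁆-isClique v u w u∈ w∈ u≢w with x∈⁅y⁆⇒x≡y v u∈ | x∈⁅y⁆⇒x≡y v w∈
  ... | refl | refl = ⊥-elim (u≢w refl)

  ∪-⁅⁆-isClique : ∀ S w → IsClique H S → AdjacentToAll S w → IsClique H (S ∪ ⁅ w ⁆)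
  ∪-⁅⁆-isClique S w S-clique w-adj u v u∈ v∈ u≢v
    with x∈p∪q⁻ S ⁅ w ⁆ u∈ | x∈p∪q⁻ S ⁅ w ⁆ v∈
  ... | inj₁ u∈S | inj₁ v∈S = S-clique u v u∈S v∈S u≢v
  ... | inj₁ u∈S | inj₂ v∈w with x∈⁅y⁆⇒x≡y w v∈w
  ...   | refl = w-adj u u∈S u≢v
  ∪-⁅⁆-isClique S w S-clique w-adj u v u∈ v∈ u≢v | inj₂ u∈w | inj₁ v∈S
    with x∈⁅y⁆⇒x≡y w u∈w
  ... | refl = subst T (Graph.sym H v u) (w-adj v v∈S λ { refl → u≢v refl })
  ∪-⁅⁆-isClique S w S-clique w-adj u v u∈ v∈ u≢v | inj₂ u∈w | inj₂ v∈w
    with x∈⁅y⁆⇒x≡y w u∈w | x∈⁅y⁆⇒x≡y w v∈w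
  ... | refl | refl = ⊥-elim (u≢v refl)

  extend-isClique : ∀ S ws → IsClique H S → IsClique H (extend S ws)
  extend-isClique S []       S-clique = S-clique
  extend-isClique S (w ∷ ws) S-clique with adjacentToAll? S w
  ... | yes w-adj = extend-isClique (S ∪ ⁅ w ⁆) ws (∪-⁅⁆-isClique S w S-clique w-adj)
  ... | no  _     = extend-isClique S ws S-clique

  -- A candidate lying in some clique above the result was adjacent to
  -- everything chosen before it, so it was added.
  extend-absorbs : ∀ S ws S′ → extend S ws ⊆ S′ → IsClique H S′ →
                   ∀ {w} → w ∈ S′ → w List.∈ ws → w ∈ extend S ws
  extend-absorbs S (x ∷ xs) S′ sub S′-clique w∈S′ w∈ws with adjacentToAll? S x | w∈ws
  ... | yes _ | here refl = ⊆-extend (S ∪ ⁅ x ⁆) xs (q⊆p∪q S ⁅ x ⁆ (x∈⁅x⁆ x))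
  ... | yes _ | there w∈xs = extend-absorbs (S ∪ ⁅ x ⁆) xs S′ sub S′-clique w∈S′ w∈xs
  ... | no ¬x-adj | here refl =
    ⊥-elim (¬x-adj λ u u∈S u≢x → S′-clique u x (sub (⊆-extend S xs u∈S)) w∈S′ u≢x)
  ... | no _ | there w∈xs = extend-absorbs S xs S′ sub S′-clique w∈S′ w∈xs

  extend-isMaximalClique : ∀ S → IsClique H S → IsMaximalClique H (extend S (allFin n))
  extend-isMaximalClique S S-clique =
    extend-isClique S (allFin n) S-clique ,
    λ { S′ (sub , w , w∈S′ , w∉) S′-clique →
          w∉ (extend-absorbs S (allFin n) S′ sub S′-clique w∈S′ (∈-allFin w)) }

  maximalClique-∋ : ∀ v → Σ (Subset n) λ M → IsMaximalClique H M × v ∈ M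
  maximalClique-∋ v =
    extend ⁅ v ⁆ (allFin n) ,
    extend-isMaximalClique ⁅ v ⁆ (⁅⁆-isClique v) ,
    ⊆-extend ⁅ v ⁆ (allFin n) (x∈⁅x⁆ v)

module _ {n : ℕ} (G : Graph n) where

  adj-complement⇒¬adj : ∀ {u v} → T (adj (complement G) u v) → ¬ T (adj G u v)
  adj-complement⇒¬adj uv∈Gᶜ uv∈G =
    subst T (Equivalence.to T-not-≡ (proj₂ (Equivalence.to T-∧ uv∈Gᶜ))) uv∈G

  isCliqueᶜ⇒¬adj : ∀ {S u v} → IsClique (complement G) S → u ∈ S → v ∈ S → ¬ T (adj G u v)
  isCliqueᶜ⇒¬adj {u = u} {v} S-clique u∈S v∈S with u ≟ v
  ... | yes refl = subst T (Graph.irrefl G u)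
  ... | no  u≢v  = adj-complement⇒¬adj (S-clique u v u∈S v∈S u≢v)

  cliqueCoverᶜ⇒properColouring : (L : List (Subset n)) →
    (∀ {S} → S List.∈ L → IsClique (complement G) S) →
    (∀ v → Any (v ∈_) L) → ProperColouring G (length L)
  cliqueCoverᶜ⇒properColouring L L-cliques cover = colour , proper
    where
    colour : Fin n → Fin (length L)
    colour v = index (cover v)

    proper : ∀ u v → T (adj G u v) → ¬ colour u ≡ colour v
    proper u v uv∈G same = isCliqueᶜ⇒¬adj (L-cliques (∈-lookup (colour v))) u∈ v∈ uv∈G
      where
      v∈ : v ∈ lookup L (colour v)
      v∈ = lookup-index (cover v)
      u∈ : u ∈ lookup L (colour v)
      u∈ = subst (λ i → u ∈ lookup L i) same (lookup-index (cover u))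

mainTheorem4 : ∀ (n : ℕ) (G : Graph n)
    (dec : Decidable (IsMaximalClique (complement G))) →
    χ≤ G (mc (complement G) dec)
mainTheorem4 n G dec =
  cliqueCoverᶜ⇒properColouring G maximalCliques
    (λ M∈ → proj₁ (proj₂ (∈-filter⁻ dec {xs = allSubsets n} M∈)))
    covered
  where
  open MaximalExtension (complement G)

  maximalCliques : List (Subset n)
  maximalCliques = filter dec (allSubsets n)

  covered : ∀ v → Any (v ∈_) maximalCliques
  covered v with maximalClique-∋ v
  ... | M , M-maximal , v∈M =
    Any.map (λ { refl → v∈M }) (∈-filter⁺ dec (∈-allSubsets M) M-maximal)
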